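{- If a nominal poset $\mathcal L$ is nominally complete and is a $\sigma$-algebra over a termlike $\sigma$-algebra with monotone $\sigma$-action, then $\mathcal L$ is finitely fresh-complete.
   Context: Atoms $\mathbb A$ (countably infinite; $a,b$ distinct), permutations, swappings $(a\ b)$, nominal sets, support $\mathrm{supp}$, freshness, equivariance as standard. A nominal poset is a nominal set with an equivariant partial order $\le$; it is nominally complete if every finitely supported subset (under the pointwise permutation action) has a greatest lower bound. For finite $X\subseteq\mathcal L$ and finite $A\subseteq\mathbb A$, the $A\#$limit of $X$ is the greatest element of $\{x'\mid A\cap\mathrm{supp}(x')=\emptyset,\ x'\le x\ \forall x\in X\}$; $\mathcal L$ is finitely fresh-complete if all $A\#$limits exist. Termlike $\sigma$-algebra $\mathsf U$: nominal set with equivariant $x[a:=u]$ and equivariant injection $\mathrm{atm}:\mathbb A\to\mathsf U$ satisfying $a[a:=x]=x$; $x[a:=a]=x$; $a\#x\Rightarrow x[a:=u]=x$; $b\#x\Rightarrow x[a:=u]=((b\ a)\cdot x)[b:=u]$; $a\#v\Rightarrow x[a:=u][b:=v]=x[b:=v][a:=u[b:=v]]$; a $\sigma$-algebra over $\mathsf U$ satisfies the last four axioms. Monotone: $x\le y\Rightarrow x[a:=u]\le y[a:=u]$. -}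

module Defs where

open import Data.Nat using (ℕ; _≟_)
open import Data.Product using (Σ; ∃; _×_; _,_)
open import Data.List using (List; []; _∷_; _++_)
open import Data.List.Membership.Propositional using (_∈_)
open import Relation.Nullary using (¬_; yes; no)
open import Relation.Binary.PropositionalEquality using (_≡_; _≢_)
open import Relation.Binary.Structures using (IsPartialOrder)
open import Function.Bundles using (_⇔_)

Atom : Set
Atom = ℕ

-- Finite permutations of atoms, represented as finite composites of
-- swappings (which generate all finite permutations).  The list
-- (a₁ , b₁) ∷ ... ∷ (aₙ , bₙ) ∷ [] stands for (a₁ b₁) ∘ ... ∘ (aₙ bₙ).

Perm : Set
Perm = List (Atom × Atom)

swapAtom : Atom → Atom → Atom → Atom
swapAtom a b c with c ≟ a
... | yes _ = b
... | no _ with c ≟ b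
...   | yes _ = a
...   | no _ = c

swp : Atom → Atom → Perm
swp a b = (a , b) ∷ []

apply : Perm → Atom → Atom
apply [] c = c
apply ((a , b) ∷ p) c = swapAtom a b (apply p c)

record PermSet : Set₁ where
  field
    Carrier : Set
    act     : Perm → Carrier → Carrier
    act-id   : ∀ x → act [] x ≡ x
    act-comp : ∀ p q x → act (p ++ q) x ≡ act p (act q x)
    -- the action only depends on the permutation, not its presentation
    act-ext  : ∀ p q → (∀ c → apply p c ≡ apply q c) → ∀ x → act p x ≡ act q x

module _ (X : PermSet) where
  open PermSet X

  Fixes : Perm → List Atom → Set
  Fixes π A = ∀ a → a ∈ A → apply π a ≡ a

  Supports : List Atom → Carrier → Set
  Supports A x = ∀ π → Fixes π A → act π x ≡ x

  -- a ∈ supp x : supp x is the least finite support, i.e. the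
  -- intersection of all finite supports of x
  _∈supp_ : Atom → Carrier → Set
  a ∈supp x = ∀ A → Supports A x → a ∈ A

  Fresh : Atom → Carrier → Set
  Fresh a x = ¬ (a ∈supp x)

  FinSuppSubset : (Carrier → Set) → Set
  FinSuppSubset S = ∃ λ A → ∀ π → Fixes π A → ∀ x → S x ⇔ S (act π x)

record NominalSet : Set₁ where
  field
    permSet : PermSet
  open PermSet permSet public
  field
    finSupp : ∀ x → ∃ λ A → Supports permSet A x

record NominalPoset : Set₁ where
  field
    nom : NominalSet
  open NominalSet nom public
  field
    _≤_ : Carrier → Carrier → Set
    isPartialOrder : IsPartialOrder _≡_ _≤_
    ≤-equivariant : ∀ π x y → x ≤ y → act π x ≤ act π y

module _ (L : NominalPoset) where
  open NominalPoset L

  IsGLB : (Carrier → Set) → Carrier → Set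
  IsGLB S m = (∀ s → S s → m ≤ s) × (∀ m' → (∀ s → S s → m' ≤ s) → m' ≤ m)

  NominallyComplete : Set₁
  NominallyComplete = ∀ (S : Carrier → Set) → FinSuppSubset permSet S → ∃ λ m → IsGLB S m

  FreshLowerBound : List Carrier → List Atom → Carrier → Set
  FreshLowerBound X A x' = (∀ a → a ∈ A → Fresh permSet a x') × (∀ x → x ∈ X → x' ≤ x)

  IsFreshLimit : List Carrier → List Atom → Carrier → Set
  IsFreshLimit X A g = FreshLowerBound X A g × (∀ x' → FreshLowerBound X A x' → x' ≤ g)

  FinitelyFreshComplete : Set
  FinitelyFreshComplete = ∀ (X : List Carrier) (A : List Atom) → ∃ λ g → IsFreshLimit X A g

record TermlikeSigmaAlgebra : Set₁ where
  field
    nom : NominalSet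
  open NominalSet nom public
  field
    sub : Carrier → Atom → Carrier → Carrier
    atm : Atom → Carrier
    sub-equivariant : ∀ π x a u → act π (sub x a u) ≡ sub (act π x) (apply π a) (act π u)
    atm-equivariant : ∀ π a → act π (atm a) ≡ atm (apply π a)
    atm-injective   : ∀ a b → atm a ≡ atm b → a ≡ b
    var     : ∀ a x → sub (atm a) a x ≡ x
    id-sub  : ∀ x a → sub x a (atm a) ≡ x
    garbage : ∀ x a u → Fresh permSet a x → sub x a u ≡ x
    alpha   : ∀ x a b u → a ≢ b → Fresh permSet b x → sub x a u ≡ sub (act (swp b a) x) b u
    sub-sub : ∀ x a b u v → a ≢ b → Fresh permSet a v →
              sub (sub x a u) b v ≡ sub (sub x b v) a (sub u b v)

module _ (U : TermlikeSigmaAlgebra) where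
  module U = TermlikeSigmaAlgebra U

  record SigmaAlgebraOver (X : NominalSet) : Set where
    open NominalSet X
    field
      sub : Carrier → Atom → U.Carrier → Carrier
      sub-equivariant : ∀ π x a u → act π (sub x a u) ≡ sub (act π x) (apply π a) (U.act π u)
      id-sub  : ∀ x a → sub x a (U.atm a) ≡ x
      garbage : ∀ x a u → Fresh permSet a x → sub x a u ≡ x
      alpha   : ∀ x a b u → a ≢ b → Fresh permSet b x → sub x a u ≡ sub (act (swp b a) x) b u
      sub-sub : ∀ x a b u v → a ≢ b → Fresh U.permSet a v →
                sub (sub x a u) b v ≡ sub (sub x b v) a (U.sub u b v)

  Monotone : (L : NominalPoset) → SigmaAlgebraOver (NominalPoset.nom L) → Set
  Monotone L σ = ∀ x y a u → x ≤ y → sub x a u ≤ sub y a u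
    where open NominalPoset L
          open SigmaAlgebraOver σ

-- For an atom a and y ∈ L let ∀a.y be the meet of the instances y[a:=u], u ∈ U.
-- That set is supported by supp(y) ∖ {a}: a permutation fixing those atoms either
-- fixes a as well, or moves a to a fresh atom c, and then α-renaming turns the
-- permuted instance y[c:=π·u] back into y[a:=π·u].  Hence its meet exists and
-- a # ∀a.y.  Monotonicity together with garbage collection (x[a:=u] = x for a # x)
-- shows that every a-fresh element below y lies below all instances, so ∀a.y is
-- the greatest a-fresh element below y.  The A#limit of X is obtained from the
-- meet of X by generalizing over the atoms of A one at a time; generalizing never
-- destroys freshness, since supports only shrink.
module Submission where

open import Defs
open import Data.Nat using (_≟_)
open import Data.Nat.Properties using (≟-diag)
open import Data.Product using (∃; _,_; proj₁; proj₂)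
open import Data.List using (List; []; _∷_; _++_; [_]; reverse; filter; foldr)
open import Data.List.Properties using (unfold-reverse; reverse-involutive)
open import Data.List.Membership.Propositional using (_∈_; _∉_)
open import Data.List.Membership.Propositional.Properties
  using (∈-++⁺ˡ; ∈-++⁺ʳ; ∈-filter⁺; ∈-filter⁻)
open import Data.List.Relation.Binary.Subset.Propositional using (_⊆_)
open import Data.List.Relation.Unary.Any using (here; there)
open import Relation.Nullary using (Dec; yes; no; ¬?)
open import Relation.Nullary.Decidable using (dec-no)
open import Relation.Binary.PropositionalEquality
  using (_≡_; _≢_; refl; sym; trans; cong; cong₂; subst; ≢-sym; module ≡-Reasoning)
open import Relation.Binary.Structures using (IsPartialOrder)
open import Function.Bundles using (mk⇔)

open ≡-Reasoning

swapAtom-left : ∀ a b → swapAtom a b a ≡ b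
swapAtom-left a b rewrite ≟-diag (refl {x = a}) = refl

swapAtom-right : ∀ a b → swapAtom a b b ≡ a
swapAtom-right a b with b ≟ a
... | yes b≡a = b≡a
... | no _ rewrite ≟-diag (refl {x = b}) = refl

swapAtom-other : ∀ {a b c} → c ≢ a → c ≢ b → swapAtom a b c ≡ c
swapAtom-other {a} {b} {c} c≢a c≢b rewrite dec-no (c ≟ a) c≢a | dec-no (c ≟ b) c≢b = refl

swapAtom-involutive : ∀ a b c → swapAtom a b (swapAtom a b c) ≡ c
swapAtom-involutive a b c = involution (c ≟ a) (c ≟ b)
  where
  involution : Dec (c ≡ a) → Dec (c ≡ b) → swapAtom a b (swapAtom a b c) ≡ c
  involution (yes c≡a) _ = subst (λ x → swapAtom a b (swapAtom a b x) ≡ x) (sym c≡a)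
    (trans (cong (swapAtom a b) (swapAtom-left a b)) (swapAtom-right a b))
  involution (no _) (yes c≡b) = subst (λ x → swapAtom a b (swapAtom a b x) ≡ x) (sym c≡b)
    (trans (cong (swapAtom a b) (swapAtom-right a b)) (swapAtom-left a b))
  involution (no c≢a) (no c≢b) =
    trans (cong (swapAtom a b) (swapAtom-other c≢a c≢b)) (swapAtom-other c≢a c≢b)

apply-++ : ∀ p q c → apply (p ++ q) c ≡ apply p (apply q c)
apply-++ []            q c = refl
apply-++ ((a , b) ∷ p) q c = cong (swapAtom a b) (apply-++ p q c)

-- Each generator is an involution, so the reversed word is the inverse permutation.
apply-reverse-inverseˡ : ∀ p c → apply (reverse p) (apply p c) ≡ c
apply-reverse-inverseˡ []            c = refl
apply-reverse-inverseˡ ((a , b) ∷ p) c = begin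
  apply (reverse ((a , b) ∷ p)) (swapAtom a b (apply p c))
    ≡⟨ cong (λ r → apply r (swapAtom a b (apply p c))) (unfold-reverse (a , b) p) ⟩
  apply (reverse p ++ [ (a , b) ]) (swapAtom a b (apply p c))
    ≡⟨ apply-++ (reverse p) [ (a , b) ] _ ⟩
  apply (reverse p) (swapAtom a b (swapAtom a b (apply p c)))
    ≡⟨ cong (apply (reverse p)) (swapAtom-involutive a b (apply p c)) ⟩
  apply (reverse p) (apply p c)
    ≡⟨ apply-reverse-inverseˡ p c ⟩
  c ∎

apply-reverse-inverseʳ : ∀ p c → apply p (apply (reverse p) c) ≡ c
apply-reverse-inverseʳ p c =
  subst (λ q → apply q (apply (reverse p) c) ≡ c) (reverse-involutive p)
        (apply-reverse-inverseˡ (reverse p) c)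

apply-injective : ∀ π {a c} → apply π a ≡ apply π c → a ≡ c
apply-injective π {a} {c} eq = begin
  a                                ≡⟨ sym (apply-reverse-inverseˡ π a) ⟩
  apply (reverse π) (apply π a)    ≡⟨ cong (apply (reverse π)) eq ⟩
  apply (reverse π) (apply π c)    ≡⟨ apply-reverse-inverseˡ π c ⟩
  c                                ∎

_∖_ : List Atom → Atom → List Atom
E ∖ a = filter (λ e → ¬? (e ≟ a)) E

∈-∖⁺ : ∀ {E a c} → c ∈ E → c ≢ a → c ∈ E ∖ a
∈-∖⁺ {a = a} = ∈-filter⁺ (λ e → ¬? (e ≟ a))

∈-∖⁻ : ∀ {E a c} → c ∈ E ∖ a → c ∈ E
∈-∖⁻ {E} {a} c∈E∖a = proj₁ (∈-filter⁻ (λ e → ¬? (e ≟ a)) {xs = E} c∈E∖a)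

∉-∖ : ∀ E a → a ∉ E ∖ a
∉-∖ E a a∈E∖a = proj₂ (∈-filter⁻ (λ e → ¬? (e ≟ a)) {xs = E} a∈E∖a) refl

module PermSetProperties (P : PermSet) where
  open PermSet P

  StableUnder : List Atom → (Carrier → Set) → Set
  StableUnder A S = ∀ π → Fixes P π A → ∀ x → S x → S (act π x)

  act-trivial : ∀ π → (∀ c → apply π c ≡ c) → ∀ x → act π x ≡ x
  act-trivial π π≗id x = trans (act-ext π [] π≗id x) (act-id x)

  act-reverse-inverseˡ : ∀ π x → act (reverse π) (act π x) ≡ x
  act-reverse-inverseˡ π x = trans (sym (act-comp (reverse π) π x))
    (act-trivial (reverse π ++ π)
      (λ c → trans (apply-++ (reverse π) π c) (apply-reverse-inverseˡ π c)) x)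

  act-reverse-inverseʳ : ∀ π x → act π (act (reverse π) x) ≡ x
  act-reverse-inverseʳ π x = trans (sym (act-comp π (reverse π) x))
    (act-trivial (π ++ reverse π)
      (λ c → trans (apply-++ π (reverse π) c) (apply-reverse-inverseʳ π c)) x)

  Fixes-reverse : ∀ π {A} → Fixes P π A → Fixes P (reverse π) A
  Fixes-reverse π fix c c∈A = begin
    apply (reverse π) c              ≡⟨ cong (apply (reverse π)) (sym (fix c c∈A)) ⟩
    apply (reverse π) (apply π c)    ≡⟨ apply-reverse-inverseˡ π c ⟩
    c                                ∎

  StableUnder⇒FinSuppSubset : ∀ {S} A → StableUnder A S → FinSuppSubset P S
  StableUnder⇒FinSuppSubset {S} A stable = A , λ π fix x → mk⇔ (stable π fix x)
    (λ Sπx → subst S (act-reverse-inverseˡ π x)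
                     (stable (reverse π) (Fixes-reverse π fix) (act π x) Sπx))

  Supports-⊆ : ∀ {C D x} → C ⊆ D → Supports P C x → Supports P D x
  Supports-⊆ C⊆D supp π fix = supp π (λ c c∈C → fix c (C⊆D c∈C))

  ∉-support⇒Fresh : ∀ {E x c} → Supports P E x → c ∉ E → Fresh P c x
  ∉-support⇒Fresh {E} supp c∉E c∈supp = c∉E (c∈supp E supp)

  act-cong-on-support : ∀ {E x} π ρ → Supports P E x →
                        (∀ e → e ∈ E → apply π e ≡ apply ρ e) → act π x ≡ act ρ x
  act-cong-on-support {E} {x} π ρ supp π≗ρ = begin
    act π x                              ≡⟨ sym (act-reverse-inverseʳ ρ (act π x)) ⟩
    act ρ (act (reverse ρ) (act π x))    ≡⟨ cong (act ρ) (sym (act-comp (reverse ρ) π x)) ⟩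
    act ρ (act (reverse ρ ++ π) x)       ≡⟨ cong (act ρ) (supp (reverse ρ ++ π) ρ⁻¹π-fixes) ⟩
    act ρ x                              ∎
    where
    ρ⁻¹π-fixes : Fixes P (reverse ρ ++ π) E
    ρ⁻¹π-fixes e e∈E = begin
      apply (reverse ρ ++ π) e            ≡⟨ apply-++ (reverse ρ) π e ⟩
      apply (reverse ρ) (apply π e)       ≡⟨ cong (apply (reverse ρ)) (π≗ρ e e∈E) ⟩
      apply (reverse ρ) (apply ρ e)       ≡⟨ apply-reverse-inverseˡ ρ e ⟩
      e                                   ∎

  Fixes-∖-fixing : ∀ π {E a} → Fixes P π (E ∖ a) → apply π a ≡ a → Fixes P π E
  Fixes-∖-fixing π {a = a} fix πa≡a e e∈E with e ≟ a
  ... | yes refl = πa≡a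
  ... | no e≢a   = fix e (∈-∖⁺ e∈E e≢a)

  Fixes-∖-moved-∉ : ∀ π {E a} → Fixes P π (E ∖ a) → apply π a ≢ a → apply π a ∉ E
  Fixes-∖-moved-∉ π {a = a} fix πa≢a πa∈E =
    πa≢a (apply-injective π (fix (apply π a) (∈-∖⁺ πa∈E πa≢a)))

  Fixes-∖-act-swap : ∀ π {E a x} → Supports P E x → Fixes P π (E ∖ a) → apply π a ∉ E →
                     act π x ≡ act (swp (apply π a) a) x
  Fixes-∖-act-swap π {E} {a} supp fix πa∉E = act-cong-on-support π (swp (apply π a) a) supp agree
    where
    agree : ∀ e → e ∈ E → apply π e ≡ swapAtom (apply π a) a e
    agree e e∈E with e ≟ a
    ... | yes refl = sym (swapAtom-right (apply π a) a)
    ... | no e≢a   = trans (fix e (∈-∖⁺ e∈E e≢a))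
                           (sym (swapAtom-other (λ e≡πa → πa∉E (subst (_∈ E) e≡πa e∈E)) e≢a))

module NominalSetProperties (X : NominalSet) where
  open NominalSet X
  open PermSetProperties permSet

  listSupport : (xs : List Carrier) → ∃ λ C → ∀ x → x ∈ xs → Supports permSet C x
  listSupport []       = [] , λ _ ()
  listSupport (x ∷ xs) with finSupp x | listSupport xs
  ... | Cx , supp-x | C , supp-xs = Cx ++ C , supports
    where
    supports : ∀ z → z ∈ x ∷ xs → Supports permSet (Cx ++ C) z
    supports z (here refl)  = Supports-⊆ ∈-++⁺ˡ supp-x
    supports z (there z∈xs) = Supports-⊆ (∈-++⁺ʳ Cx) (supp-xs z z∈xs)

  ∈-FinSuppSubset : (xs : List Carrier) → FinSuppSubset permSet (_∈ xs)
  ∈-FinSuppSubset xs with listSupport xs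
  ... | C , supp = StableUnder⇒FinSuppSubset C
    (λ π fix x x∈xs → subst (_∈ xs) (sym (supp x x∈xs π fix)) x∈xs)

module NominalPosetProperties (L : NominalPoset) where
  open NominalPoset L
  open PermSetProperties permSet
  module ≤ = IsPartialOrder isPartialOrder

  -- Permutations fixing A permute the set, so they map its meet to a meet of it.
  IsGLB-supported : ∀ {A S m} → StableUnder A S → IsGLB L S m → Supports permSet A m
  IsGLB-supported {A} {S} {m} stable (lower , greatest) π fix =
    ≤.antisym (πm≤m π fix)
              (subst (_≤ act π m) (act-reverse-inverseʳ π m)
                     (≤-equivariant π _ m (πm≤m (reverse π) (Fixes-reverse π fix))))
    where
    πm≤m : ∀ ρ → Fixes permSet ρ A → act ρ m ≤ m
    πm≤m ρ fixρ = greatest (act ρ m) λ s Ss →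
      subst (act ρ m ≤_) (act-reverse-inverseʳ ρ s)
        (≤-equivariant ρ m _ (lower _ (stable (reverse ρ) (Fixes-reverse ρ fixρ) s Ss)))

module Generalization (L : NominalPoset) (U : TermlikeSigmaAlgebra)
  (σ : SigmaAlgebraOver U (NominalPoset.nom L))
  (complete : NominallyComplete L) (mono : Monotone U L σ) where
  open NominalPoset L
  open PermSetProperties permSet
  open NominalPosetProperties L
  module Terms = TermlikeSigmaAlgebra U
  module σ = SigmaAlgebraOver σ

  Instance : Atom → Carrier → Carrier → Set
  Instance a y z = ∃ λ u → z ≡ σ.sub y a u

  Instance-stable : ∀ {E y} a → Supports permSet E y → StableUnder (E ∖ a) (Instance a y)
  Instance-stable {E} {y} a supp π fix _ (u , refl) =
    Terms.act π u , trans (σ.sub-equivariant π y a u) (renamed (apply π a ≟ a))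
    where
    w : Terms.Carrier
    w = Terms.act π u
    renamed : Dec (apply π a ≡ a) → σ.sub (act π y) (apply π a) w ≡ σ.sub y a w
    renamed (yes πa≡a) = cong₂ (λ x b → σ.sub x b w) (supp π (Fixes-∖-fixing π fix πa≡a)) πa≡a
    renamed (no  πa≢a) = begin
      σ.sub (act π y) c w              ≡⟨ cong (λ x → σ.sub x c w) (Fixes-∖-act-swap π supp fix c∉E) ⟩
      σ.sub (act (swp c a) y) c w      ≡⟨ sym (σ.alpha y a c w (≢-sym πa≢a) (∉-support⇒Fresh supp c∉E)) ⟩
      σ.sub y a w                      ∎
      where
      c : Atom
      c = apply π a
      c∉E : c ∉ E
      c∉E = Fixes-∖-moved-∉ π fix πa≢a

  generalize : Atom → Carrier → Carrier
  generalize a y = proj₁ (complete (Instance a y)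
    (StableUnder⇒FinSuppSubset _ (Instance-stable a (proj₂ (finSupp y)))))

  generalize-isGLB : ∀ a y → IsGLB L (Instance a y) (generalize a y)
  generalize-isGLB a y = proj₂ (complete (Instance a y)
    (StableUnder⇒FinSuppSubset _ (Instance-stable a (proj₂ (finSupp y)))))

  generalize-supported : ∀ {E y} a → Supports permSet E y → Supports permSet (E ∖ a) (generalize a y)
  generalize-supported a supp = IsGLB-supported (Instance-stable a supp) (generalize-isGLB a _)

  generalize-≤ : ∀ a y → generalize a y ≤ y
  generalize-≤ a y = proj₁ (generalize-isGLB a y) y (Terms.atm a , sym (σ.id-sub y a))

  generalize-fresh : ∀ a y → Fresh permSet a (generalize a y)
  generalize-fresh a y =
    ∉-support⇒Fresh (generalize-supported a (proj₂ (finSupp y))) (∉-∖ (proj₁ (finSupp y)) a)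

  generalize-preserves-Fresh : ∀ {c} a y → Fresh permSet c y → Fresh permSet c (generalize a y)
  generalize-preserves-Fresh a y c#y c∈supp =
    c#y λ E supp → ∈-∖⁻ (c∈supp (E ∖ a) (generalize-supported a supp))

  generalize-greatest : ∀ {x} a y → Fresh permSet a x → x ≤ y → x ≤ generalize a y
  generalize-greatest {x} a y a#x x≤y = proj₂ (generalize-isGLB a y) x
    λ { _ (u , refl) → subst (_≤ σ.sub y a u) (σ.garbage x a u a#x) (mono x y a u x≤y) }

  generalizeAll : List Atom → Carrier → Carrier
  generalizeAll A y = foldr generalize y A

  generalizeAll-≤ : ∀ A y → generalizeAll A y ≤ y
  generalizeAll-≤ []      y = ≤.refl
  generalizeAll-≤ (a ∷ A) y = ≤.trans (generalize-≤ a _) (generalizeAll-≤ A y)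

  generalizeAll-fresh : ∀ A y b → b ∈ A → Fresh permSet b (generalizeAll A y)
  generalizeAll-fresh (a ∷ A) y b (here refl)  = generalize-fresh a _
  generalizeAll-fresh (a ∷ A) y b (there b∈A) =
    generalize-preserves-Fresh a _ (generalizeAll-fresh A y b b∈A)

  generalizeAll-greatest : ∀ {x} A y → (∀ b → b ∈ A → Fresh permSet b x) → x ≤ y →
                           x ≤ generalizeAll A y
  generalizeAll-greatest []      y A#x x≤y = x≤y
  generalizeAll-greatest (a ∷ A) y A#x x≤y =
    generalize-greatest a _ (A#x a (here refl))
      (generalizeAll-greatest A y (λ b b∈A → A#x b (there b∈A)) x≤y)

  generalizeAll-isFreshLimit : ∀ {X m} A → IsGLB L (_∈ X) m → IsFreshLimit L X A (generalizeAll A m)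
  generalizeAll-isFreshLimit {m = m} A (lower , greatest) =
    (generalizeAll-fresh A m , λ x x∈X → ≤.trans (generalizeAll-≤ A m) (lower x x∈X)) ,
    λ { x (A#x , x≤X) → generalizeAll-greatest A m A#x (greatest x x≤X) }

proposition8p20 : (L : NominalPoset) (U : TermlikeSigmaAlgebra)
    (σ : SigmaAlgebraOver U (NominalPoset.nom L)) →
    NominallyComplete L → Monotone U L σ → FinitelyFreshComplete L
proposition8p20 L U σ complete mono X A
  with complete (_∈ X) (NominalSetProperties.∈-FinSuppSubset (NominalPoset.nom L) X)
... | m , meet = generalizeAll A m , generalizeAll-isFreshLimit A meet
  where open Generalization L U σ complete mono
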